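{- Let $n\geqslant1$ and let $c\in\mathfrak{S}_{n+1}$ be a Coxeter element. For every $k\in\{1,\dots,n\}$, $$\#D_k(\boldsymbol{\lambda}(c))=\min\bigl(\#\{\ell\in L_c\cup\{1\}:\ell\leqslant k\},\ \#\{r\in R_c\cup\{n+1\}:r>k\}\bigr).$$
   Context: Let $s_i=(i,i+1)\in\mathfrak{S}_{n+1}$. A Coxeter element of $\mathfrak{S}_{n+1}$ is a product $s_{\sigma(1)}\cdots s_{\sigma(n)}$ for some permutation $\sigma$ of $\{1,\dots,n\}$; it can be written uniquely as a cycle $(c_1,\dots,c_m,c_{m+1},\dots,c_{n+1})$ with $1=c_1<c_2<\dots<c_m=n+1>c_{m+1}>\dots>c_{n+1}>1$; set $L_c=\{c_2,\dots,c_{m-1}\}$, $R_c=\{c_{m+1},\dots,c_{n+1}\}$. Writing $L_c\cup\{1\}=\{a_1<\dots<a_p\}$, the partition $\boldsymbol{\lambda}(c)$ has parts $\boldsymbol{\lambda}(c)_i=\#\{r\in R_c\cup\{n+1\}:a_i<r\}$, $1\leqslant i\leqslant p$. For a partition $\lambda$ with Ferrers diagram $\operatorname{Fer}(\lambda)=\{(i,j):1\leqslant i\leqslant\ell(\lambda),1\leqslant j\leqslant\lambda_i\}$, the $k$-th diagonal is $D_k(\lambda)=\{(i,j)\in\operatorname{Fer}(\lambda):\lambda_1+i-j=k\}$. -}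

module Defs where

open import Data.Nat using (ℕ; zero; suc; _+_; _<_; _≤_; _<?_; _≤?_)
import Data.Nat as ℕ
open import Data.Fin using (Fin; toℕ; fromℕ; inject₁) renaming (suc to fsuc)
import Data.Fin.Properties as FinP
open import Data.Fin.Permutation using (Permutation′; _⟨$⟩ʳ_)
open import Data.List using (List; []; _∷_; map; foldr; length; filter; takeWhile; dropWhile; upTo; allFin; _++_)
import Data.List.Membership.DecPropositional as MemDec
open import Data.Product using (_×_; _,_; proj₁; proj₂)
open import Relation.Nullary using (¬?)
open import Function using (_∘_; id)

-- Points of {1,…,n+1} are encoded as Fin (suc n): x ∈ Fin (suc n) stands for toℕ x + 1.

-- simple transposition s_{j+1} = (j+1, j+2) for j : Fin n
s : {n : ℕ} → Fin n → Fin (suc n) → Fin (suc n)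
s j x with x FinP.≟ inject₁ j
... | Relation.Nullary.yes _ = fsuc j
... | Relation.Nullary.no _ with x FinP.≟ fsuc j
...   | Relation.Nullary.yes _ = inject₁ j
...   | Relation.Nullary.no _ = x

-- the Coxeter element s_{σ(1)} ⋯ s_{σ(n)} (composition of functions, rightmost applied first)
coxeter : {n : ℕ} → Permutation′ n → Fin (suc n) → Fin (suc n)
coxeter {n} σ = foldr (λ j f → s j ∘ f) id (map (σ ⟨$⟩ʳ_) (allFin n))

iter : {A : Set} → ℕ → (A → A) → A → A
iter zero f x = x
iter (suc m) f x = f (iter m f x)

-- the cycle (c_1, c_2, …, c_{n+1}) of c, starting at c_1 = 1
cycleList : {n : ℕ} → (Fin (suc n) → Fin (suc n)) → List (Fin (suc n))
cycleList {n} c = map (λ j → iter j c Fin.zero) (upTo (suc n))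
  where import Data.Fin as Fin

-- L_c ∪ {1} = {c_1, …, c_{m-1}} (elements before n+1 in the cycle)
leftsWith1 : {n : ℕ} → (Fin (suc n) → Fin (suc n)) → List (Fin (suc n))
leftsWith1 {n} c = takeWhile (λ x → ¬? (x FinP.≟ fromℕ n)) (cycleList c)

-- R_c ∪ {n+1} = {c_m = n+1, c_{m+1}, …, c_{n+1}}
rightsWithTop : {n : ℕ} → (Fin (suc n) → Fin (suc n)) → List (Fin (suc n))
rightsWithTop {n} c = dropWhile (λ x → ¬? (x FinP.≟ fromℕ n)) (cycleList c)

-- a_1 < ⋯ < a_p : L_c ∪ {1} listed increasingly
sortedLefts : {n : ℕ} → (Fin (suc n) → Fin (suc n)) → List (Fin (suc n))
sortedLefts {n} c = filter (λ x → MemDec._∈?_ (FinP._≟_ {suc n}) x (leftsWith1 c)) (allFin (suc n))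

partitionOf : {n : ℕ} → (Fin (suc n) → Fin (suc n)) → List ℕ
partitionOf c = map (λ a → length (filter (λ r → toℕ a <? toℕ r) (rightsWithTop c))) (sortedLefts c)

ferFrom : ℕ → List ℕ → List (ℕ × ℕ)
ferFrom i [] = []
ferFrom i (p ∷ ps) = map (λ j → (i , suc j)) (upTo p) ++ ferFrom (suc i) ps

Fer : List ℕ → List (ℕ × ℕ)
Fer = ferFrom 1

head0 : List ℕ → ℕ
head0 [] = 0
head0 (p ∷ _) = p

-- k-th diagonal D_k(λ) = {(i,j) ∈ Fer(λ) : λ_1 + i - j = k}  (i.e. λ_1 + i = k + j)
D : ℕ → List ℕ → List (ℕ × ℕ)
D k lam = filter (λ ij → head0 lam + proj₁ ij ℕ.≟ k + proj₂ ij) (Fer lam)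

-- Write c = s_{σ(1)} ⋯ s_{σ(n)}. Induction on n shows that the cycle of c through 1 climbs
-- through L_c ∪ {1} to n + 1 and then descends through R_c: deleting s_n from the word leaves a
-- Coxeter element c′ of the smaller group, and s_n commutes to the right end of the word when
-- s_{n-1} stands before it (c = c′ s_n, whose cycle passes n and then n + 1, so n joins L_c) and
-- to the left end otherwise (c = s_n c′ is the conjugate of c′ s_n by s_n, so n joins R_c).
--
-- With the cycle in this shape, the row of λ(c) belonging to a ∈ L_c ∪ {1} has index
-- i = #{ℓ ≤ a} and length λ₁ − #{r ∈ R_c : r < a}, so its last cell lies on D_a and its first on
-- D_{λ₁+i−1}. Hence the row meets D_k iff a ≤ k < λ₁ + i, and counting such rows gives
-- #{ℓ ≤ k} − max(0, k − λ₁) = min(#{ℓ ≤ k}, #{r ∈ R_c ∪ {n+1} : r > k}).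

module Submission where

open import Data.Bool using (Bool; true; false; not; _∧_; T)
open import Data.Bool.Properties using (∧-identityʳ; ∧-zeroʳ)
open import Data.Empty using (⊥-elim)
open import Data.Fin using (Fin; toℕ; fromℕ; fromℕ<; inject₁) renaming (zero to fzero; suc to fsuc)
import Data.Fin.Properties as Finₚ
open import Data.Fin.Permutation using (Permutation′; _⟨$⟩ʳ_; _⟨$⟩ˡ_; inverseˡ; inverseʳ)
open import Data.List
  using (List; []; _∷_; _++_; [_]; map; foldr; filter; length; reverse; upTo; downFrom; applyUpTo; iterate;
         takeWhile; dropWhile; tabulate; allFin)
open import Data.List.Properties
  using (map-++; map-id-local; map-cong; map-∘; map-upTo; map-applyUpTo; map-tabulate; length-map; length-++;
         length-upTo; reverse-upTo; ++-assoc; ++-identityʳ; unfold-reverse; upTo-∷ʳ; filter-++; filter-accept;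
         filter-reject; filter-none)
open import Data.List.Membership.Propositional using (_∈_; _∉_; find; lose)
open import Data.List.Membership.Propositional.Properties
  using (∈-∃++; ∈-++⁺ˡ; ∈-++⁺ʳ; ∈-map⁺; ∈-map⁻; ∈-allFin; ∈-filter⁺; ∈-filter⁻; ∈-upTo⁺)
import Data.List.Membership.DecPropositional as MemDec
open import Data.List.Relation.Unary.All as All using (All; []; _∷_)
import Data.List.Relation.Unary.All.Properties as Allₚ
open import Data.List.Relation.Unary.Any using (here; there; any?)
open import Data.List.Relation.Unary.AllPairs using (_∷_)
open import Data.List.Relation.Unary.Unique.Propositional using (Unique)
import Data.List.Relation.Unary.Unique.Propositional.Properties as Uniqueₚ
open import Data.Nat
  using (ℕ; zero; suc; _+_; _∸_; _⊓_; _<_; _≤_; _<?_; _≤?_; _≟_; z≤n; z<s; s≤s)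
open import Data.Nat.Properties
open import Data.Product using (Σ; _×_; _,_; proj₁; proj₂)
open import Data.Sum using (inj₁; inj₂)
open import Data.Unit using (⊤; tt)
open import Function using (_∘_; mk⇔; case_of_)
open import Relation.Nullary using (¬_; yes; no; does; ¬?)
open import Relation.Nullary.Decidable using (T?; dec-true; dec-false; does-⇔)
open import Relation.Binary.PropositionalEquality hiding ([_])
open import Relation.Unary using (Decidable)

open import Defs

open MemDec {A = ℕ} _≟_ using () renaming (_∈?_ to _∈ℕ?_)
open ≡-Reasoning

filter-cong-on : ∀ {A : Set} {P Q : A → Set} (P? : Decidable P) (Q? : Decidable Q) {xs} →
  All (λ x → does (P? x) ≡ does (Q? x)) xs → filter P? xs ≡ filter Q? xs
filter-cong-on P? Q? [] = refl
filter-cong-on P? Q? {x ∷ xs} (_ ∷ eqs) with does (P? x) | does (Q? x)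
... | true | true = cong (x ∷_) (filter-cong-on P? Q? eqs)
... | false | false = filter-cong-on P? Q? eqs

filter-upTo-suc : ∀ {P : ℕ → Set} (P? : Decidable P) m →
  filter P? (upTo (suc m)) ≡ filter P? (upTo m) ++ filter P? [ m ]
filter-upTo-suc P? m = trans (cong (filter P?) (sym (upTo-∷ʳ m))) (filter-++ P? (upTo m) [ m ])

module _ {A B : Set} (g : A → B) {P : A → Set} {Q : B → Set} (P? : Decidable P) (Q? : Decidable Q)
         (P≡Q∘g : ∀ x → does (P? x) ≡ does (Q? (g x))) where

  map-filter : ∀ xs → map g (filter P? xs) ≡ filter Q? (map g xs)
  map-filter [] = refl
  map-filter (x ∷ xs) with does (P? x) | does (Q? (g x)) | P≡Q∘g x
  ... | true | true | _ = cong (g x ∷_) (map-filter xs)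
  ... | false | false | _ = map-filter xs

  map-takeWhile : ∀ xs → map g (takeWhile P? xs) ≡ takeWhile Q? (map g xs)
  map-takeWhile [] = refl
  map-takeWhile (x ∷ xs) with does (P? x) | does (Q? (g x)) | P≡Q∘g x
  ... | true | true | _ = cong (g x ∷_) (map-takeWhile xs)
  ... | false | false | _ = refl

  map-dropWhile : ∀ xs → map g (dropWhile P? xs) ≡ dropWhile Q? (map g xs)
  map-dropWhile [] = refl
  map-dropWhile (x ∷ xs) with does (P? x) | does (Q? (g x)) | P≡Q∘g x
  ... | true | true | _ = map-dropWhile xs
  ... | false | false | _ = refl

length-filter-map : ∀ {A B : Set} {Q : B → Set} (Q? : Decidable Q) (g : A → B) xs →
  length (filter Q? (map g xs)) ≡ length (filter (Q? ∘ g) xs)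
length-filter-map Q? g xs =
  trans (cong length (sym (map-filter g (Q? ∘ g) Q? (λ _ → refl) xs)))
        (length-map g (filter (Q? ∘ g) xs))

length-filter-map-≡ : ∀ {A B : Set} {Q : B → Set} (Q? : Decidable Q) {g : A → B} {xs ys} →
  map g xs ≡ ys → length (filter (Q? ∘ g) xs) ≡ length (filter Q? ys)
length-filter-map-≡ Q? {g} {xs} refl = sym (length-filter-map Q? g xs)

module _ {A : Set} {P : A → Set} (P? : Decidable P) where

  takeWhile-++-∷ : ∀ {xs v ys} → All P xs → ¬ P v → takeWhile P? (xs ++ v ∷ ys) ≡ xs
  takeWhile-++-∷ {[]} {v} [] ¬Pv with P? v
  ... | yes Pv = ⊥-elim (¬Pv Pv)
  ... | no _ = refl
  takeWhile-++-∷ {x ∷ _} (Px ∷ Pxs) ¬Pv with P? x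
  ... | yes _ = cong (x ∷_) (takeWhile-++-∷ Pxs ¬Pv)
  ... | no ¬Px = ⊥-elim (¬Px Px)

  dropWhile-++-∷ : ∀ {xs v ys} → All P xs → ¬ P v → dropWhile P? (xs ++ v ∷ ys) ≡ v ∷ ys
  dropWhile-++-∷ {[]} {v} [] ¬Pv with P? v
  ... | yes Pv = ⊥-elim (¬Pv Pv)
  ... | no _ = refl
  dropWhile-++-∷ {x ∷ _} (Px ∷ Pxs) ¬Pv with P? x
  ... | yes _ = dropWhile-++-∷ Pxs ¬Pv
  ... | no ¬Px = ⊥-elim (¬Px Px)

∈-++-∷⁺ : ∀ {x y : ℕ} as {bs} → x ∈ as ++ bs → x ∈ as ++ y ∷ bs
∈-++-∷⁺ [] x∈ = there x∈
∈-++-∷⁺ (a ∷ as) (here x≡a) = here x≡a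
∈-++-∷⁺ (a ∷ as) (there x∈) = there (∈-++-∷⁺ as x∈)

∈-++-∷⁻ : ∀ {x y : ℕ} as {bs} → x ∈ as ++ y ∷ bs → x ≢ y → x ∈ as ++ bs
∈-++-∷⁻ [] (here x≡y) x≢y = ⊥-elim (x≢y x≡y)
∈-++-∷⁻ [] (there x∈) _ = x∈
∈-++-∷⁻ (a ∷ as) (here x≡a) _ = here x≡a
∈-++-∷⁻ (a ∷ as) (there x∈) x≢y = there (∈-++-∷⁻ as x∈ x≢y)

unique-middle : ∀ as {y : ℕ} {bs} → Unique (as ++ y ∷ bs) →
  Unique (as ++ bs) × y ∉ as ++ bs × (∀ {x} → x ∈ as → x ∉ bs)
unique-middle [] (y∉bs ∷ u) = u , (λ y∈ → All.lookup y∉bs y∈ refl) , λ ()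
unique-middle (a ∷ as) (a∉ ∷ u) with unique-middle as u
... | u′ , y∉ , disjoint =
  Allₚ.++⁺ (Allₚ.++⁻ˡ as a∉) (All.tail a∉bs) ∷ u′ ,
  (λ { (here y≡a) → All.lookup a∉bs (here refl) (sym y≡a) ; (there y∈) → y∉ y∈ }) ,
  λ { (here refl) x∈bs → All.lookup (All.tail a∉bs) x∈bs refl ; (there x∈) → disjoint x∈ }
  where a∉bs = Allₚ.++⁻ʳ as a∉

iter-suc : ∀ {A : Set} (f : A → A) j x → iter (suc j) f x ≡ iter j f (f x)
iter-suc f zero x = refl
iter-suc f (suc j) x = cong f (iter-suc f j x)

map-iter-upTo : ∀ {A : Set} (f : A → A) x m → map (λ j → iter j f x) (upTo m) ≡ iterate f x m
map-iter-upTo f x zero = refl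
map-iter-upTo f x (suc m) = cong (x ∷_) (begin
  map (λ j → iter j f x) (applyUpTo suc m)    ≡⟨ map-applyUpTo suc (λ j → iter j f x) m ⟩
  applyUpTo (λ j → iter (suc j) f x) m        ≡⟨ map-upTo (λ j → iter (suc j) f x) m ⟨
  map (λ j → iter (suc j) f x) (upTo m)       ≡⟨ map-cong (λ j → iter-suc f j x) (upTo m) ⟩
  map (λ j → iter j f (f x)) (upTo m)         ≡⟨ map-iter-upTo f (f x) m ⟩
  iterate f (f x) m                           ∎)

map-iterate : ∀ {A B : Set} {f : A → A} {g : B → B} (h : A → B) →
  (∀ x → h (f x) ≡ g (h x)) →
  ∀ x m → map h (iterate f x m) ≡ iterate g (h x) m
map-iterate h comm x zero = refl
map-iterate {f = f} {g} h comm x (suc m) =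
  cong (h x ∷_) (trans (map-iterate h comm (f x) m) (cong (λ y → iterate g y m) (comm x)))

tabulate-toℕ : ∀ {A : Set} m (f : ℕ → A) → tabulate {n = m} (f ∘ toℕ) ≡ applyUpTo f m
tabulate-toℕ zero f = refl
tabulate-toℕ (suc m) f = cong (f 0 ∷_) (tabulate-toℕ m (f ∘ suc))

map-toℕ-allFin : ∀ m → map toℕ (allFin m) ≡ upTo m
map-toℕ-allFin m = trans (map-tabulate (λ i → i) toℕ) (tabulate-toℕ m (λ i → i))

indicator : Bool → ℕ
indicator true = 1
indicator false = 0

module _ {A : Set} where

  countᵇ : (A → Bool) → List A → ℕ
  countᵇ p [] = 0
  countᵇ p (x ∷ xs) = indicator (p x) + countᵇ p xs

  length-filter : ∀ {P : A → Set} (P? : Decidable P) xs →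
    length (filter P? xs) ≡ countᵇ (does ∘ P?) xs
  length-filter P? [] = refl
  length-filter P? (x ∷ xs) with does (P? x)
  ... | true = cong suc (length-filter P? xs)
  ... | false = length-filter P? xs

  countᵇ-++ : ∀ p xs ys → countᵇ p (xs ++ ys) ≡ countᵇ p xs + countᵇ p ys
  countᵇ-++ p [] ys = refl
  countᵇ-++ p (x ∷ xs) ys =
    trans (cong (indicator (p x) +_) (countᵇ-++ p xs ys)) (sym (+-assoc (indicator (p x)) _ _))

  countᵇ-reverse : ∀ p xs → countᵇ p (reverse xs) ≡ countᵇ p xs
  countᵇ-reverse p [] = refl
  countᵇ-reverse p (x ∷ xs) = begin
    countᵇ p (reverse (x ∷ xs))                   ≡⟨ cong (countᵇ p) (unfold-reverse x xs) ⟩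
    countᵇ p (reverse xs ++ [ x ])                ≡⟨ countᵇ-++ p (reverse xs) [ x ] ⟩
    countᵇ p (reverse xs) + (indicator (p x) + 0) ≡⟨ cong₂ _+_ (countᵇ-reverse p xs) (+-identityʳ _) ⟩
    countᵇ p xs + indicator (p x)                 ≡⟨ +-comm (countᵇ p xs) _ ⟩
    countᵇ p (x ∷ xs)                             ∎

  countᵇ-filter : ∀ (p q : A → Bool) xs →
    countᵇ q (filter (T? ∘ p) xs) ≡ countᵇ (λ x → p x ∧ q x) xs
  countᵇ-filter p q [] = refl
  countᵇ-filter p q (x ∷ xs) with p x
  ... | true = cong (indicator (q x) +_) (countᵇ-filter p q xs)
  ... | false = countᵇ-filter p q xs

  countᵇ-cong-on : ∀ {p q xs} → All (λ x → p x ≡ q x) xs → countᵇ p xs ≡ countᵇ q xs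
  countᵇ-cong-on [] = refl
  countᵇ-cong-on (px≡qx ∷ eqs) = cong₂ _+_ (cong indicator px≡qx) (countᵇ-cong-on eqs)

  countᵇ-split : ∀ (p q : A → Bool) xs →
    countᵇ p xs ≡ countᵇ (λ x → p x ∧ q x) xs + countᵇ (λ x → p x ∧ not (q x)) xs
  countᵇ-split p q [] = refl
  countᵇ-split p q (x ∷ xs) with p x
  ... | false = countᵇ-split p q xs
  ... | true with q x
  ...   | true = cong suc (countᵇ-split p q xs)
  ...   | false = trans (cong suc (countᵇ-split p q xs)) (sym (+-suc _ _))

  countᵇ-complement : ∀ p xs → countᵇ p xs + countᵇ (not ∘ p) xs ≡ length xs
  countᵇ-complement p [] = refl
  countᵇ-complement p (x ∷ xs) with p x
  ... | true = cong suc (countᵇ-complement p xs)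
  ... | false = trans (+-suc _ _) (cong suc (countᵇ-complement p xs))

countᵇ-upTo-suc : ∀ p n → countᵇ p (upTo (suc n)) ≡ countᵇ p (upTo n) + indicator (p n)
countᵇ-upTo-suc p n = begin
  countᵇ p (upTo (suc n))                     ≡⟨ cong (countᵇ p) (sym (upTo-∷ʳ n)) ⟩
  countᵇ p (upTo n ++ [ n ])                  ≡⟨ countᵇ-++ p (upTo n) [ n ] ⟩
  countᵇ p (upTo n) + (indicator (p n) + 0)   ≡⟨ cong (countᵇ p (upTo n) +_) (+-identityʳ _) ⟩
  countᵇ p (upTo n) + indicator (p n)         ∎

countᵇ-downFrom : ∀ p n → countᵇ p (downFrom n) ≡ countᵇ p (upTo n)
countᵇ-downFrom p n = trans (cong (countᵇ p) (sym (reverse-upTo n))) (countᵇ-reverse p (upTo n))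

countᵇ-upTo-< : ∀ p {m n} → m ≤ n →
  countᵇ (λ x → p x ∧ does (x <? m)) (upTo n) ≡ countᵇ p (upTo m)
countᵇ-upTo-< p {m} {zero} z≤n = refl
countᵇ-upTo-< p {m} {suc n} m≤1+n with m≤n⇒m<n∨m≡n m≤1+n
... | inj₂ refl = countᵇ-cong-on
  (All.map (λ {x} x<m → trans (cong (p x ∧_) (dec-true (x <? m) x<m)) (∧-identityʳ (p x)))
           (Allₚ.all-upTo m))
... | inj₁ m<1+n = begin
  countᵇ (λ x → p x ∧ does (x <? m)) (upTo (suc n))
    ≡⟨ countᵇ-upTo-suc _ n ⟩
  countᵇ (λ x → p x ∧ does (x <? m)) (upTo n) + indicator (p n ∧ does (n <? m))
    ≡⟨ cong₂ _+_ (countᵇ-upTo-< p (≤-pred m<1+n))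
                 (cong (indicator ∘ (p n ∧_)) (dec-false (n <? m) (≤⇒≯ (≤-pred m<1+n)))) ⟩
  countᵇ p (upTo m) + indicator (p n ∧ false)
    ≡⟨ cong (λ v → countᵇ p (upTo m) + indicator v) (∧-zeroʳ (p n)) ⟩
  countᵇ p (upTo m) + 0
    ≡⟨ +-identityʳ _ ⟩
  countᵇ p (upTo m) ∎

not-<⇒≥ : ∀ x a → not (does (x <? a)) ≡ does (a ≤? x)
not-<⇒≥ x a = does-⇔ (mk⇔ ≮⇒≥ ≤⇒≯) (¬? (x <? a)) (a ≤? x)

countᵇ-upTo-split : ∀ p {a n} → a ≤ n →
  countᵇ p (upTo n) ≡ countᵇ p (upTo a) + countᵇ (λ x → p x ∧ does (a ≤? x)) (upTo n)
countᵇ-upTo-split p {a} {n} a≤n = trans (countᵇ-split p (λ x → does (x <? a)) (upTo n))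
  (cong₂ _+_ (countᵇ-upTo-< p a≤n)
             (countᵇ-cong-on (All.universal (λ x → cong (p x ∧_) (not-<⇒≥ x a)) (upTo n))))

-- Simple transpositions acting on ℕ

swap : ℕ → ℕ → ℕ
swap j x with x ≟ j
... | yes _ = suc j
... | no _ with x ≟ suc j
...   | yes _ = j
...   | no _ = x

swap-here : ∀ j → swap j j ≡ suc j
swap-here j with j ≟ j
... | yes _ = refl
... | no j≢j = ⊥-elim (j≢j refl)

swap-next : ∀ j → swap j (suc j) ≡ j
swap-next j with suc j ≟ j
... | yes 1+j≡j = ⊥-elim (1+n≢n 1+j≡j)
... | no _ with suc j ≟ suc j
...   | yes _ = refl
...   | no ne = ⊥-elim (ne refl)

swap-other : ∀ {j x} → x ≢ j → x ≢ suc j → swap j x ≡ x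
swap-other {j} {x} x≢j x≢1+j with x ≟ j
... | yes x≡j = ⊥-elim (x≢j x≡j)
... | no _ with x ≟ suc j
...   | yes x≡1+j = ⊥-elim (x≢1+j x≡1+j)
...   | no _ = refl

swap-below : ∀ {j x} → x < j → swap j x ≡ x
swap-below x<j = swap-other (<⇒≢ x<j) (<⇒≢ (m<n⇒m<1+n x<j))

swap-≥ : ∀ {j x} → j ≤ x → j ≤ swap j x
swap-≥ {j} {x} j≤x with x ≟ j
... | yes _ = n≤1+n j
... | no _ with x ≟ suc j
...   | yes _ = ≤-refl
...   | no _ = j≤x

swap-involutive : ∀ j x → swap j (swap j x) ≡ x
swap-involutive j x with x ≟ j
... | yes refl = swap-next j
... | no x≢j with x ≟ suc j
...   | yes refl = swap-here j
...   | no x≢1+j = swap-other x≢j x≢1+j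

swaps : List ℕ → ℕ → ℕ
swaps [] x = x
swaps (j ∷ js) x = swap j (swaps js x)

swaps-++ : ∀ as bs x → swaps (as ++ bs) x ≡ swaps as (swaps bs x)
swaps-++ [] bs x = refl
swaps-++ (a ∷ as) bs x = cong (swap a) (swaps-++ as bs x)

swap-< : ∀ {j m x} → suc j < m → x < m → swap j x < m
swap-< {j} {m} {x} 1+j<m x<m with x ≟ j
... | yes _ = 1+j<m
... | no _ with x ≟ suc j
...   | yes _ = <-trans (n<1+n j) 1+j<m
...   | no _ = x<m

swaps-< : ∀ {m js x} → All (λ j → suc j < m) js → x < m → swaps js x < m
swaps-< [] x<m = x<m
swaps-< (1+j<m ∷ js<m) x<m = swap-< 1+j<m (swaps-< js<m x<m)

swaps-fixes-≥ : ∀ {m js x} → All (λ j → suc j < m) js → m ≤ x → swaps js x ≡ x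
swaps-fixes-≥ [] m≤x = refl
swaps-fixes-≥ {js = j ∷ _} {x} (1+j<m ∷ js<m) m≤x rewrite swaps-fixes-≥ js<m m≤x =
  swap-other (>⇒≢ (<-≤-trans (<-trans (n<1+n j) 1+j<m) m≤x)) (>⇒≢ (<-≤-trans 1+j<m m≤x))

swap-swaps-comm : ∀ {m js} → All (λ j → suc j < m) js →
  ∀ x → swap m (swaps js x) ≡ swaps js (swap m x)
swap-swaps-comm {m} {js} js<m x with x <? m
... | yes x<m = trans (swap-below (swaps-< js<m x<m)) (cong (swaps js) (sym (swap-below x<m)))
... | no x≮m = trans (cong (swap m) (swaps-fixes-≥ js<m m≤x))
                    (sym (swaps-fixes-≥ js<m (swap-≥ m≤x)))
  where m≤x = ≮⇒≥ x≮m

swaps-fixes-top : ∀ {m js} → (∀ {x} → x ∈ js → x < m) → swaps js (suc m) ≡ suc m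
swaps-fixes-top bound = swaps-fixes-≥ (All.tabulate (s≤s ∘ bound)) ≤-refl

module _ {A : Set} where

  headOr : A → List A → A
  headOr z [] = z
  headOr z (y ∷ _) = y

  Path : (A → A) → List A → A → Set
  Path f [] z = ⊤
  Path f (x ∷ xs) z = f x ≡ headOr z xs × Path f xs z

  path-++⁻ : ∀ {f} xs {ys z} → Path f (xs ++ ys) z → Path f xs (headOr z ys) × Path f ys z
  path-++⁻ [] p = tt , p
  path-++⁻ (x ∷ []) (fx , p) = (fx , tt) , p
  path-++⁻ (x ∷ x′ ∷ xs) (fx , p) with path-++⁻ (x′ ∷ xs) p
  ... | pxs , pys = (fx , pxs) , pys

  path-++⁺ : ∀ {f} xs {ys z} → Path f xs (headOr z ys) → Path f ys z → Path f (xs ++ ys) z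
  path-++⁺ [] _ q = q
  path-++⁺ (x ∷ []) (fx , _) q = fx , q
  path-++⁺ (x ∷ x′ ∷ xs) (fx , p) q = fx , path-++⁺ (x′ ∷ xs) p q

  path-agree : ∀ {f g xs z} → All (λ x → f x ≡ g x) xs → Path g xs z → Path f xs z
  path-agree [] _ = tt
  path-agree (fx≡gx ∷ agree) (gx , p) = trans fx≡gx gx , path-agree agree p

  path-conj : ∀ {f} (τ : A → A) → (∀ x → τ (τ x) ≡ x) →
    ∀ {xs z} → Path f xs z → Path (τ ∘ f ∘ τ) (map τ xs) (τ z)
  path-conj τ τ² {[]} _ = tt
  path-conj {f} τ τ² {x ∷ []} (fx , _) = trans (cong (τ ∘ f) (τ² x)) (cong τ fx) , tt
  path-conj {f} τ τ² {x ∷ x′ ∷ xs} (fx , p) =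
    trans (cong (τ ∘ f) (τ² x)) (cong τ fx) , path-conj τ τ² p

  path-iterate : ∀ {f ys z} → Path f ys z → iterate f (headOr z ys) (length ys) ≡ ys
  path-iterate {ys = []} _ = refl
  path-iterate {ys = y ∷ ys} (fy , p) rewrite fy = cong (y ∷_) (path-iterate p)

-- The cycle of a product of all simple transpositions

lefts : (ℕ → Bool) → ℕ → List ℕ
lefts b n = filter (T? ∘ b) (upTo n)

rights : (ℕ → Bool) → ℕ → List ℕ
rights b n = filter (T? ∘ not ∘ b) (downFrom n)

-- The paper's normal form (c₁, …, c_{n+1}) of a Coxeter cycle, shifted down by one;
-- b marks L_c ∪ {1}.
CycleShape : ℕ → (ℕ → ℕ) → Set
CycleShape n f = Σ (ℕ → Bool) λ b → b 0 ≡ true × Path f (lefts b n ++ n ∷ rights b n) 0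

lefts-from-0 : ∀ {b n} → b 0 ≡ true → 1 ≤ n → Σ (List ℕ) λ xs → lefts b n ≡ 0 ∷ xs
lefts-from-0 {b} {suc m} b0 _ = _ , filter-accept (T? ∘ b) {0} {applyUpTo suc m} (subst T (sym b0) tt)

lefts-< : ∀ b n → All (_< n) (lefts b n)
lefts-< b n = Allₚ.filter⁺ (T? ∘ b) (Allₚ.all-upTo n)

rights-< : ∀ b n → All (_< n) (rights b n)
rights-< b n = Allₚ.filter⁺ (T? ∘ not ∘ b) (Allₚ.applyDownFrom⁺₁ (λ x → x) n (λ x<n → x<n))

setAt : (ℕ → Bool) → ℕ → Bool → ℕ → Bool
setAt b m v x with x ≟ m
... | yes _ = v
... | no _ = b x

setAt-here : ∀ b m v → setAt b m v m ≡ v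
setAt-here b m v with m ≟ m
... | yes _ = refl
... | no m≢m = ⊥-elim (m≢m refl)

setAt-other : ∀ {b m v x} → x ≢ m → setAt b m v x ≡ b x
setAt-other {m = m} {x = x} x≢m with x ≟ m
... | yes x≡m = ⊥-elim (x≢m x≡m)
... | no _ = refl

filter-setAt-below : ∀ (p : Bool → Bool) b m v {xs} → All (_< m) xs →
  filter (T? ∘ p ∘ setAt b m v) xs ≡ filter (T? ∘ p ∘ b) xs
filter-setAt-below p b m v xs<m =
  filter-cong-on (T? ∘ p ∘ setAt b m v) (T? ∘ p ∘ b)
    (All.map (λ x<m → cong p (setAt-other (<⇒≢ x<m))) xs<m)

lefts-suc-true : ∀ b m → b m ≡ true → lefts b (suc m) ≡ lefts b m ++ [ m ]
lefts-suc-true b m bm = begin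
  filter (T? ∘ b) (upTo (suc m))                      ≡⟨ filter-upTo-suc (T? ∘ b) m ⟩
  filter (T? ∘ b) (upTo m) ++ filter (T? ∘ b) [ m ]
    ≡⟨ cong (lefts b m ++_) (filter-accept (T? ∘ b) {m} {[]} (subst T (sym bm) tt)) ⟩
  lefts b m ++ [ m ]                                  ∎

lefts-suc-false : ∀ b m → b m ≡ false → lefts b (suc m) ≡ lefts b m
lefts-suc-false b m bm = begin
  filter (T? ∘ b) (upTo (suc m))                      ≡⟨ filter-upTo-suc (T? ∘ b) m ⟩
  filter (T? ∘ b) (upTo m) ++ filter (T? ∘ b) [ m ]
    ≡⟨ cong (lefts b m ++_) (filter-reject (T? ∘ b) {m} {[]} (subst T bm)) ⟩
  lefts b m ++ []                                     ≡⟨ ++-identityʳ (lefts b m) ⟩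
  lefts b m                                           ∎

rights-suc-true : ∀ b m → b m ≡ true → rights b (suc m) ≡ rights b m
rights-suc-true b m bm = filter-reject (T? ∘ not ∘ b) {m} {downFrom m} (subst (T ∘ not) bm)

rights-suc-false : ∀ b m → b m ≡ false → rights b (suc m) ≡ m ∷ rights b m
rights-suc-false b m bm = filter-accept (T? ∘ not ∘ b) {m} {downFrom m} (subst (T ∘ not) (sym bm) tt)

lefts-setAt : ∀ b m v → lefts (setAt b m v) m ≡ lefts b m
lefts-setAt b m v = filter-setAt-below (λ v → v) b m v (Allₚ.all-upTo m)

rights-setAt : ∀ b m v → rights (setAt b m v) m ≡ rights b m
rights-setAt b m v = filter-setAt-below not b m v (Allₚ.applyDownFrom⁺₁ (λ x → x) m (λ x<m → x<m))

path-∘swap : ∀ {m g} b → Path g (lefts b m ++ m ∷ rights b m) 0 → g (suc m) ≡ suc m →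
  Path (g ∘ swap m) (lefts b m ++ m ∷ suc m ∷ rights b m) 0
path-∘swap {m} {g} b p gfix with path-++⁻ (lefts b m) p
... | pL , gm , pR = path-++⁺ (lefts b m) (path-agree (agreeBelow (lefts-< b m)) pL)
                       ( trans (cong g (swap-here m)) gfix
                       , trans (cong g (swap-next m)) gm
                       , path-agree (agreeBelow (rights-< b m)) pR)
  where
  agreeBelow : ∀ {xs} → All (_< m) xs → All (λ x → g (swap m x) ≡ g x) xs
  agreeBelow = All.map (cong g ∘ swap-below)

cycleShape-∘swap : ∀ {m g} → CycleShape m g → g (suc m) ≡ suc m →
  CycleShape (suc m) (g ∘ swap m)
cycleShape-∘swap {m} {g} (b , b0 , p) gfix =
  b′ , b′0 , subst (λ xs → Path (g ∘ swap m) xs 0) (sym shape) (path-∘swap b p gfix)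
  where
  b′ = setAt b m true
  b′0 : b′ 0 ≡ true
  b′0 with 0 ≟ m
  ... | yes _ = refl
  ... | no _ = b0
  shape : lefts b′ (suc m) ++ suc m ∷ rights b′ (suc m) ≡ lefts b m ++ m ∷ suc m ∷ rights b m
  shape = begin
    lefts b′ (suc m) ++ suc m ∷ rights b′ (suc m)
      ≡⟨ cong₂ (λ l r → l ++ suc m ∷ r) (lefts-suc-true b′ m (setAt-here b m true))
                                        (rights-suc-true b′ m (setAt-here b m true)) ⟩
    (lefts b′ m ++ [ m ]) ++ suc m ∷ rights b′ m
      ≡⟨ cong₂ (λ l r → (l ++ [ m ]) ++ suc m ∷ r) (lefts-setAt b m true) (rights-setAt b m true) ⟩
    (lefts b m ++ [ m ]) ++ suc m ∷ rights b m
      ≡⟨ ++-assoc (lefts b m) [ m ] _ ⟩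
    lefts b m ++ m ∷ suc m ∷ rights b m ∎

-- s_m g is the conjugate of g s_m by s_m, so its cycle is that of g s_m with m, m + 1 exchanged.
cycleShape-swap∘ : ∀ {m g} → 1 ≤ m → CycleShape m g → g (suc m) ≡ suc m →
  CycleShape (suc m) (swap m ∘ g)
cycleShape-swap∘ {m} {g} 0<m (b , b0 , p) gfix =
  b′ , trans (setAt-other (<⇒≢ 0<m)) b0 ,
  subst₂ (Path (swap m ∘ g)) shape (swap-below 0<m)
    (path-agree (All.universal (λ x → cong (swap m ∘ g) (sym (swap-involutive m x))) _)
      (path-conj (swap m) (swap-involutive m) (path-∘swap b p gfix)))
  where
  b′ = setAt b m false
  L = lefts b m
  R = rights b m
  shape : map (swap m) (L ++ m ∷ suc m ∷ R) ≡ lefts b′ (suc m) ++ suc m ∷ rights b′ (suc m)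
  shape = begin
    map (swap m) (L ++ m ∷ suc m ∷ R)
      ≡⟨ map-++ (swap m) L _ ⟩
    map (swap m) L ++ swap m m ∷ swap m (suc m) ∷ map (swap m) R
      ≡⟨ cong₂ _++_ (map-id-local (All.map swap-below (lefts-< b m)))
                    (cong₂ _∷_ (swap-here m)
                      (cong₂ _∷_ (swap-next m) (map-id-local (All.map swap-below (rights-< b m))))) ⟩
    L ++ suc m ∷ m ∷ R
      ≡⟨ cong₂ (λ l r → l ++ suc m ∷ m ∷ r) (lefts-setAt b m false) (rights-setAt b m false) ⟨
    lefts b′ m ++ suc m ∷ m ∷ rights b′ m
      ≡⟨ cong₂ (λ l r → l ++ suc m ∷ r) (lefts-suc-false b′ m (setAt-here b m false))
                                        (rights-suc-false b′ m (setAt-here b m false)) ⟨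
    lefts b′ (suc m) ++ suc m ∷ rights b′ (suc m) ∎

cycleShape-cong : ∀ {n f g} → (∀ x → f x ≡ g x) → CycleShape n g → CycleShape n f
cycleShape-cong f≗g (b , b0 , p) = b , b0 , path-agree (All.universal f≗g _) p

Enumerates : ℕ → List ℕ → Set
Enumerates n js = Unique js × (∀ {x} → x ∈ js → x < n) × (∀ {x} → x < n → x ∈ js)

enumerates-remove : ∀ {m} as {bs} → Enumerates (suc m) (as ++ m ∷ bs) →
  Enumerates m (as ++ bs) × (∀ {x} → x ∈ as → x ∉ bs)
enumerates-remove {m} as (u , bound , complete) with unique-middle as u
... | u′ , m∉ , disjoint =
  (u′ , (λ x∈ → ≤∧≢⇒< (≤-pred (bound (∈-++-∷⁺ as x∈))) λ { refl → m∉ x∈ })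
      , (λ x<m → ∈-++-∷⁻ as (complete (m<n⇒m<1+n x<m)) (<⇒≢ x<m))) ,
  disjoint

all-suc-< : ∀ {m xs} → (∀ {x} → x ∈ xs → x < m) → (∀ {x} → x ∈ xs → suc x ≢ m) →
  All (λ j → suc j < m) xs
all-suc-< bound ≢m = All.tabulate (λ x∈ → ≤∧≢⇒< (bound x∈) (≢m x∈))

-- s_m commutes with every s_j, j ∈ bs, unless s_{m-1} lies in bs; then it commutes with every s_j, j ∈ as.
cycleShape-insert-top : ∀ {m} as bs →
  (∀ {x} → x ∈ as ++ bs → x < m) → (∀ {x} → x ∈ as → x ∉ bs) →
  CycleShape m (swaps (as ++ bs)) → CycleShape (suc m) (swaps (as ++ m ∷ bs))
cycleShape-insert-top {m} as bs bound disjoint shape with any? (λ j → suc j ≟ m) bs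
... | no m-1∉bs = cycleShape-cong swaps≗ (cycleShape-∘swap shape (swaps-fixes-top bound))
  where
  bs<m : All (λ j → suc j < m) bs
  bs<m = all-suc-< (bound ∘ ∈-++⁺ʳ as) (λ x∈ 1+x≡m → m-1∉bs (lose x∈ 1+x≡m))
  swaps≗ : ∀ x → swaps (as ++ m ∷ bs) x ≡ swaps (as ++ bs) (swap m x)
  swaps≗ x = begin
    swaps (as ++ m ∷ bs) x         ≡⟨ swaps-++ as (m ∷ bs) x ⟩
    swaps as (swap m (swaps bs x)) ≡⟨ cong (swaps as) (swap-swaps-comm bs<m x) ⟩
    swaps as (swaps bs (swap m x)) ≡⟨ sym (swaps-++ as bs (swap m x)) ⟩
    swaps (as ++ bs) (swap m x)    ∎
... | yes m-1∈bs with find m-1∈bs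
...   | j , j∈bs , refl =
  cycleShape-cong swaps≗ (cycleShape-swap∘ (s≤s z≤n) shape (swaps-fixes-top bound))
  where
  as<m : All (λ a → suc a < suc j) as
  as<m = all-suc-< (bound ∘ ∈-++⁺ˡ)
    (λ a∈ 1+a≡1+j → disjoint a∈ (subst (_∈ bs) (sym (suc-injective 1+a≡1+j)) j∈bs))
  swaps≗ : ∀ x → swaps (as ++ suc j ∷ bs) x ≡ swap (suc j) (swaps (as ++ bs) x)
  swaps≗ x = begin
    swaps (as ++ suc j ∷ bs) x           ≡⟨ swaps-++ as (suc j ∷ bs) x ⟩
    swaps as (swap (suc j) (swaps bs x)) ≡⟨ sym (swap-swaps-comm as<m (swaps bs x)) ⟩
    swap (suc j) (swaps as (swaps bs x)) ≡⟨ cong (swap (suc j)) (sym (swaps-++ as bs x)) ⟩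
    swap (suc j) (swaps (as ++ bs) x)    ∎

swaps-cycleShape : ∀ n js → Enumerates n js → CycleShape n (swaps js)
swaps-cycleShape zero [] _ = (λ _ → true) , refl , refl , tt
swaps-cycleShape zero (j ∷ _) (_ , bound , _) = ⊥-elim (n≮0 (bound (here refl)))
swaps-cycleShape (suc m) js e@(_ , _ , complete) with ∈-∃++ (complete (n<1+n m))
... | as , bs , refl with enumerates-remove as e
...   | e′@(_ , bound , _) , disjoint =
  cycleShape-insert-top as bs bound disjoint (swaps-cycleShape m (as ++ bs) e′)

length-cycle : ∀ b n → length (lefts b n ++ n ∷ rights b n) ≡ suc n
length-cycle b n = begin
  length (lefts b n ++ n ∷ rights b n)                   ≡⟨ length-++ (lefts b n) ⟩
  length (lefts b n) + suc (length (rights b n))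
    ≡⟨ cong₂ (λ l r → l + suc r) (length-filter (T? ∘ b) (upTo n))
             (trans (length-filter (T? ∘ not ∘ b) (downFrom n)) (countᵇ-downFrom (not ∘ b) n)) ⟩
  countᵇ b (upTo n) + suc (countᵇ (not ∘ b) (upTo n))    ≡⟨ +-suc _ _ ⟩
  suc (countᵇ b (upTo n) + countᵇ (not ∘ b) (upTo n))    ≡⟨ cong suc (countᵇ-complement b (upTo n)) ⟩
  suc (length (upTo n))                                  ≡⟨ cong suc (length-upTo n) ⟩
  suc n                                                  ∎

-- Diagonals of a Ferrers diagram

rowHits : ℕ → ℕ → ℕ → ℕ
rowHits X k p = length (filter (λ j → X ≟ k + suc j) (upTo p))

rowHits-suc : ∀ X k p → rowHits X k (suc p) ≡ rowHits X k p + indicator (does (X ≟ k + suc p))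
rowHits-suc X k p = begin
  rowHits X k (suc p)                           ≡⟨ length-filter hit? (upTo (suc p)) ⟩
  countᵇ (does ∘ hit?) (upTo (suc p))           ≡⟨ countᵇ-upTo-suc (does ∘ hit?) p ⟩
  countᵇ (does ∘ hit?) (upTo p) + indicator (does (hit? p))
    ≡⟨ cong (_+ indicator (does (hit? p))) (length-filter hit? (upTo p)) ⟨
  rowHits X k p + indicator (does (X ≟ k + suc p)) ∎
  where hit? = λ j → X ≟ k + suc j

rowHits-≤ : ∀ {X k} p → X ≤ k → rowHits X k p ≡ 0
rowHits-≤ {X} {k} p X≤k = cong length (filter-none (λ j → X ≟ k + suc j)
  (All.universal (λ j → <⇒≢ (≤-<-trans X≤k (m<m+n k z<s))) (upTo p)))

rowHits-> : ∀ {X k} p → k + p < X → rowHits X k p ≡ 0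
rowHits-> {X} {k} p k+p<X = cong length (filter-none (λ j → X ≟ k + suc j)
  (All.map (λ j<p → >⇒≢ (≤-<-trans (+-monoʳ-≤ k j<p) k+p<X)) (Allₚ.all-upTo p)))

rowHits-one : ∀ {X k} p → k < X → X ≤ k + p → rowHits X k p ≡ 1
rowHits-one {X} {k} zero k<X X≤k+0 = ⊥-elim (<⇒≱ k<X (subst (X ≤_) (+-identityʳ k) X≤k+0))
rowHits-one {X} {k} (suc p) k<X X≤k+1+p with X ≟ k + suc p
... | yes refl = begin
  rowHits X k (suc p)   ≡⟨ rowHits-suc X k p ⟩
  rowHits X k p + indicator (does (X ≟ X))
    ≡⟨ cong₂ _+_ (rowHits-> p (+-monoʳ-< k (n<1+n p))) (cong indicator (dec-true (X ≟ X) refl)) ⟩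
  1                     ∎
... | no X≢k+1+p = begin
  rowHits X k (suc p)   ≡⟨ rowHits-suc X k p ⟩
  rowHits X k p + indicator (does (X ≟ k + suc p))
    ≡⟨ cong₂ _+_ (rowHits-one p k<X X≤k+p) (cong indicator (dec-false (X ≟ k + suc p) X≢k+1+p)) ⟩
  1                     ∎
  where X≤k+p = ≤-pred (subst (suc X ≤_) (+-suc k p) (≤∧≢⇒< X≤k+1+p X≢k+1+p))

-- length (D k λ) unfolds to diagonalFrom (head0 λ) k 1 λ.
diagonalFrom : ℕ → ℕ → ℕ → List ℕ → ℕ
diagonalFrom h k i rows = length (filter (λ ij → h + proj₁ ij ≟ k + proj₂ ij) (ferFrom i rows))

diagonalFrom-∷ : ∀ h k i p ps →
  diagonalFrom h k i (p ∷ ps) ≡ rowHits (h + i) k p + diagonalFrom h k (suc i) ps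
diagonalFrom-∷ h k i p ps = begin
  length (filter onDiagonal? (row ++ ferFrom (suc i) ps))
    ≡⟨ cong length (filter-++ onDiagonal? row _) ⟩
  length (filter onDiagonal? row ++ filter onDiagonal? (ferFrom (suc i) ps))
    ≡⟨ length-++ (filter onDiagonal? row) ⟩
  length (filter onDiagonal? row) + diagonalFrom h k (suc i) ps
    ≡⟨ cong (_+ _) (length-filter-map onDiagonal? (λ j → i , suc j) (upTo p)) ⟩
  rowHits (h + i) k p + diagonalFrom h k (suc i) ps ∎
  where
  onDiagonal? = λ (ij : ℕ × ℕ) → h + proj₁ ij ≟ k + proj₂ ij
  row = map (λ j → i , suc j) (upTo p)

diagonalFrom-∷ʳ : ∀ h k i ps p →
  diagonalFrom h k i (ps ++ [ p ]) ≡ diagonalFrom h k i ps + rowHits (h + (i + length ps)) k p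
diagonalFrom-∷ʳ h k i [] p = begin
  diagonalFrom h k i [ p ]       ≡⟨ diagonalFrom-∷ h k i p [] ⟩
  rowHits (h + i) k p + 0        ≡⟨ +-identityʳ _ ⟩
  rowHits (h + i) k p            ≡⟨ cong (λ j → rowHits (h + j) k p) (+-identityʳ i) ⟨
  rowHits (h + (i + 0)) k p      ∎
diagonalFrom-∷ʳ h k i (q ∷ ps) p = begin
  diagonalFrom h k i (q ∷ ps ++ [ p ])
    ≡⟨ diagonalFrom-∷ h k i q (ps ++ [ p ]) ⟩
  rowHits (h + i) k q + diagonalFrom h k (suc i) (ps ++ [ p ])
    ≡⟨ cong (rowHits (h + i) k q +_) (diagonalFrom-∷ʳ h k (suc i) ps p) ⟩
  rowHits (h + i) k q + (diagonalFrom h k (suc i) ps + rowHits (h + suc (i + length ps)) k p)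
    ≡⟨ +-assoc (rowHits (h + i) k q) _ _ ⟨
  rowHits (h + i) k q + diagonalFrom h k (suc i) ps + rowHits (h + suc (i + length ps)) k p
    ≡⟨ cong₂ _+_ (diagonalFrom-∷ h k i q ps)
                 (cong (λ j → rowHits (h + j) k p) (+-suc i (length ps))) ⟨
  diagonalFrom h k i (q ∷ ps) + rowHits (h + (i + length (q ∷ ps))) k p ∎

m∸[m∸n]≡m⊓n : ∀ m n → m ∸ (m ∸ n) ≡ m ⊓ n
m∸[m∸n]≡m⊓n m n = begin
  m ∸ (m ∸ n)                 ≡⟨ cong (_∸ (m ∸ n)) (m⊓n+n∸m≡n n m) ⟨
  (n ⊓ m + (m ∸ n)) ∸ (m ∸ n) ≡⟨ m+n∸n≡m (n ⊓ m) (m ∸ n) ⟩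
  n ⊓ m                       ≡⟨ ⊓-comm n m ⟩
  m ⊓ n                       ∎

m∸[[m+n]∸[1+n+o]]≡m⊓[1+o] : ∀ m n o → m ∸ ((m + n) ∸ suc (n + o)) ≡ m ⊓ suc o
m∸[[m+n]∸[1+n+o]]≡m⊓[1+o] m n o = begin
  m ∸ ((m + n) ∸ suc (n + o)) ≡⟨ cong₂ (λ x y → m ∸ (x ∸ y)) (+-comm m n) (sym (+-suc n o)) ⟩
  m ∸ ((n + m) ∸ (n + suc o)) ≡⟨ cong (m ∸_) ([m+n]∸[m+o]≡n∸o n m (suc o)) ⟩
  m ∸ (m ∸ suc o)             ≡⟨ m∸[m∸n]≡m⊓n m (suc o) ⟩
  m ⊓ suc o                   ∎

-- A row of length ℓ with index 1 + c below a first row of length h ends on diagonal m + 1,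
-- so for m < k it meets D_k exactly when k ∸ h ≤ c.
rowHits-rank : ∀ {h c k ℓ m} → h + suc c ≡ ℓ + suc m → m < k →
  (c ∸ (k ∸ h)) + rowHits (h + suc c) k ℓ ≡ suc c ∸ (k ∸ h)
rowHits-rank {h} {c} {k} {ℓ} {m} rowEnd m<k with k ∸ h ≤? c
... | yes k∸h≤c = begin
  (c ∸ (k ∸ h)) + rowHits (h + suc c) k ℓ
    ≡⟨ cong (c ∸ (k ∸ h) +_) (rowHits-one ℓ k<h+1+c h+1+c≤k+ℓ) ⟩
  (c ∸ (k ∸ h)) + 1                       ≡⟨ +-comm _ 1 ⟩
  suc (c ∸ (k ∸ h))                       ≡⟨ +-∸-assoc 1 k∸h≤c ⟨
  suc c ∸ (k ∸ h)                         ∎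
  where
  k<h+1+c : k < h + suc c
  k<h+1+c = ≤-<-trans (≤-trans (m≤n+m∸n k h) (+-monoʳ-≤ h k∸h≤c)) (+-monoʳ-< h (n<1+n c))
  h+1+c≤k+ℓ : h + suc c ≤ k + ℓ
  h+1+c≤k+ℓ = subst₂ _≤_ (sym rowEnd) (+-comm ℓ k) (+-monoʳ-≤ ℓ m<k)
... | no k∸h≰c = begin
  (c ∸ (k ∸ h)) + rowHits (h + suc c) k ℓ
    ≡⟨ cong₂ _+_ (m≤n⇒m∸n≡0 (<⇒≤ c<k∸h)) (rowHits-≤ ℓ h+1+c≤k) ⟩
  0                                       ≡⟨ m≤n⇒m∸n≡0 c<k∸h ⟨
  suc c ∸ (k ∸ h)                         ∎
  where
  c<k∸h = ≰⇒> k∸h≰c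
  h<k : h < k
  h<k = m∸n≢0⇒n<m (λ k∸h≡0 → k∸h≰c (subst (_≤ c) (sym k∸h≡0) z≤n))
  h+1+c≤k : h + suc c ≤ k
  h+1+c≤k = subst (h + suc c ≤_) (m+[n∸m]≡n (<⇒≤ h<k)) (+-monoʳ-≤ h c<k∸h)

module Counting (n : ℕ) (b : ℕ → Bool) (b0 : b 0 ≡ true) where

  leftsBelow rightsBelow : ℕ → ℕ
  leftsBelow m = countᵇ b (upTo m)
  rightsBelow m = countᵇ (not ∘ b) (upTo m)

  leftsBelow+rightsBelow : ∀ m → leftsBelow m + rightsBelow m ≡ m
  leftsBelow+rightsBelow m = trans (countᵇ-complement b (upTo m)) (length-upTo m)

  rightsAbove : (ℕ → Bool) → ℕ
  rightsAbove above = countᵇ (λ x → not (b x) ∧ above x) (upTo n)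

  rowLength : ℕ → ℕ
  rowLength a = length (filter (a <?_) (n ∷ rights b n))

  firstRow : ℕ
  firstRow = rowLength 0

  head0-rows : 1 ≤ n → head0 (map rowLength (lefts b n)) ≡ firstRow
  head0-rows 0<n with lefts-from-0 {b} b0 0<n
  ... | _ , lefts≡ rewrite lefts≡ = refl

  length-filter-rights : ∀ {P : ℕ → Set} (P? : Decidable P) → P n →
    length (filter P? (n ∷ rights b n)) ≡ suc (rightsAbove (does ∘ P?))
  length-filter-rights P? Pn = begin
    length (filter P? (n ∷ rights b n))
      ≡⟨ length-filter P? (n ∷ rights b n) ⟩
    indicator (does (P? n)) + countᵇ (does ∘ P?) (filter (T? ∘ not ∘ b) (downFrom n))
      ≡⟨ cong₂ _+_ (cong indicator (dec-true (P? n) Pn))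
                   (countᵇ-filter (not ∘ b) (does ∘ P?) (downFrom n)) ⟩
    suc (countᵇ (λ x → not (b x) ∧ does (P? x)) (downFrom n))
      ≡⟨ cong suc (countᵇ-downFrom _ n) ⟩
    suc (rightsAbove (does ∘ P?)) ∎

  firstRow≡ : 1 ≤ n → firstRow ≡ suc (rightsBelow n)
  firstRow≡ 0<n = trans (length-filter-rights (0 <?_) 0<n)
                        (cong suc (countᵇ-cong-on (All.universal rights-positive (upTo n))))
    where
    rights-positive : ∀ x → not (b x) ∧ does (0 <? x) ≡ not (b x)
    rights-positive zero rewrite b0 = refl
    rights-positive (suc x) = ∧-identityʳ (not (b (suc x)))

  rowLength+rightsBelow : ∀ {a} → a < n → b a ≡ true → rowLength a + rightsBelow a ≡ firstRow
  rowLength+rightsBelow {a} a<n ba = begin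
    rowLength a + rightsBelow a
      ≡⟨ cong (_+ rightsBelow a) (length-filter-rights (a <?_) a<n) ⟩
    suc (rightsAbove (does ∘ (a <?_)) + rightsBelow a)
      ≡⟨ cong suc (+-comm _ (rightsBelow a)) ⟩
    suc (rightsBelow a + rightsAbove (does ∘ (a <?_)))
      ≡⟨ cong (λ r → suc (rightsBelow a + r)) (countᵇ-cong-on (All.universal ≤⇒< (upTo n))) ⟨
    suc (rightsBelow a + rightsAbove (does ∘ (a ≤?_)))
      ≡⟨ cong suc (countᵇ-upTo-split (not ∘ b) (<⇒≤ a<n)) ⟨
    suc (rightsBelow n)
      ≡⟨ firstRow≡ (≤-<-trans z≤n a<n) ⟨
    firstRow ∎
    where
    ≤⇒< : ∀ x → not (b x) ∧ does (a ≤? x) ≡ not (b x) ∧ does (a <? x)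
    ≤⇒< x with x ≟ a
    ... | yes refl rewrite ba = refl
    ... | no x≢a = cong (not (b x) ∧_)
                        (does-⇔ (mk⇔ (λ a≤x → ≤∧≢⇒< a≤x (x≢a ∘ sym)) <⇒≤) (a ≤? x) (a <? x))

  rowEnd : ∀ {a} → a < n → b a ≡ true → firstRow + suc (leftsBelow a) ≡ rowLength a + suc a
  rowEnd {a} a<n ba = begin
    firstRow + suc (leftsBelow a)
      ≡⟨ cong (_+ suc (leftsBelow a)) (rowLength+rightsBelow a<n ba) ⟨
    rowLength a + rightsBelow a + suc (leftsBelow a)
      ≡⟨ +-assoc (rowLength a) _ _ ⟩
    rowLength a + (rightsBelow a + suc (leftsBelow a))
      ≡⟨ cong (rowLength a +_) (trans (+-suc _ _) (cong suc (+-comm (rightsBelow a) _))) ⟩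
    rowLength a + suc (leftsBelow a + rightsBelow a)
      ≡⟨ cong (λ x → rowLength a + suc x) (leftsBelow+rightsBelow a) ⟩
    rowLength a + suc a ∎

  leftsBelow-suc : ∀ m → leftsBelow (suc m) ≡ leftsBelow m + indicator (b m)
  leftsBelow-suc = countᵇ-upTo-suc b

  module _ (k : ℕ) where

    diagonalBelow : ℕ → ℕ
    diagonalBelow m = diagonalFrom firstRow k 1 (map rowLength (lefts b m))

    diagonalBelow-false : ∀ {m} → b m ≡ false → diagonalBelow (suc m) ≡ diagonalBelow m
    diagonalBelow-false {m} bm = cong (diagonalFrom firstRow k 1 ∘ map rowLength) (lefts-suc-false b m bm)

    diagonalBelow-true : ∀ {m} → b m ≡ true →
      diagonalBelow (suc m) ≡ diagonalBelow m + rowHits (firstRow + suc (leftsBelow m)) k (rowLength m)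
    diagonalBelow-true {m} bm = begin
      diagonalFrom firstRow k 1 (map rowLength (lefts b (suc m)))
        ≡⟨ cong (diagonalFrom firstRow k 1 ∘ map rowLength) (lefts-suc-true b m bm) ⟩
      diagonalFrom firstRow k 1 (map rowLength (lefts b m ++ [ m ]))
        ≡⟨ cong (diagonalFrom firstRow k 1) (map-++ rowLength (lefts b m) [ m ]) ⟩
      diagonalFrom firstRow k 1 (map rowLength (lefts b m) ++ [ rowLength m ])
        ≡⟨ diagonalFrom-∷ʳ firstRow k 1 (map rowLength (lefts b m)) (rowLength m) ⟩
      diagonalBelow m + rowHits (firstRow + suc (length (map rowLength (lefts b m)))) k (rowLength m)
        ≡⟨ cong (λ i → diagonalBelow m + rowHits (firstRow + suc i) k (rowLength m))
                (trans (length-map rowLength (lefts b m)) (length-filter (T? ∘ b) (upTo m))) ⟩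
      diagonalBelow m + rowHits (firstRow + suc (leftsBelow m)) k (rowLength m) ∎

    diagonalBelow-≤ : k ≤ n → ∀ m → m ≤ k → diagonalBelow m ≡ leftsBelow m ∸ (k ∸ firstRow)
    diagonalBelow-≤ k≤n zero _ = sym (0∸n≡0 (k ∸ firstRow))
    diagonalBelow-≤ k≤n (suc m) m<k with b m in bm
    ... | false = begin
      diagonalBelow (suc m)                ≡⟨ diagonalBelow-false bm ⟩
      diagonalBelow m                      ≡⟨ diagonalBelow-≤ k≤n m (<⇒≤ m<k) ⟩
      leftsBelow m ∸ (k ∸ firstRow)        ≡⟨ cong (_∸ (k ∸ firstRow)) (+-identityʳ (leftsBelow m)) ⟨
      leftsBelow m + 0 ∸ (k ∸ firstRow)    ≡⟨ cong (λ v → leftsBelow m + indicator v ∸ (k ∸ firstRow)) bm ⟨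
      leftsBelow m + indicator (b m) ∸ (k ∸ firstRow) ≡⟨ cong (_∸ (k ∸ firstRow)) (leftsBelow-suc m) ⟨
      leftsBelow (suc m) ∸ (k ∸ firstRow)  ∎
    ... | true = begin
      diagonalBelow (suc m)
        ≡⟨ diagonalBelow-true bm ⟩
      diagonalBelow m + rowHits (firstRow + suc (leftsBelow m)) k (rowLength m)
        ≡⟨ cong (_+ rowHits (firstRow + suc (leftsBelow m)) k (rowLength m))
                (diagonalBelow-≤ k≤n m (<⇒≤ m<k)) ⟩
      leftsBelow m ∸ (k ∸ firstRow) + rowHits (firstRow + suc (leftsBelow m)) k (rowLength m)
        ≡⟨ rowHits-rank (rowEnd (<-≤-trans m<k k≤n) bm) m<k ⟩
      suc (leftsBelow m) ∸ (k ∸ firstRow)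
        ≡⟨ cong (_∸ (k ∸ firstRow)) (+-comm 1 (leftsBelow m)) ⟩
      leftsBelow m + 1 ∸ (k ∸ firstRow)
        ≡⟨ cong (λ v → leftsBelow m + indicator v ∸ (k ∸ firstRow)) bm ⟨
      leftsBelow m + indicator (b m) ∸ (k ∸ firstRow)
        ≡⟨ cong (_∸ (k ∸ firstRow)) (leftsBelow-suc m) ⟨
      leftsBelow (suc m) ∸ (k ∸ firstRow) ∎

    diagonalBelow-≥ : ∀ m → k ≤ m → m ≤ n → diagonalBelow m ≡ diagonalBelow k
    diagonalBelow-≥ m k≤m m≤n with m≤n⇒m<n∨m≡n k≤m
    diagonalBelow-≥ m k≤m m≤n | inj₂ refl = refl
    diagonalBelow-≥ (suc m) k≤m m<n | inj₁ k<1+m with b m in bm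
    ... | false = trans (diagonalBelow-false bm) (diagonalBelow-≥ m (≤-pred k<1+m) (<⇒≤ m<n))
    ... | true = begin
      diagonalBelow (suc m)
        ≡⟨ diagonalBelow-true bm ⟩
      diagonalBelow m + rowHits (firstRow + suc (leftsBelow m)) k (rowLength m)
        ≡⟨ cong₂ _+_ (diagonalBelow-≥ m (≤-pred k<1+m) (<⇒≤ m<n)) (rowHits-> (rowLength m) k+ℓ<end) ⟩
      diagonalBelow k + 0
        ≡⟨ +-identityʳ _ ⟩
      diagonalBelow k ∎
      where
      k+ℓ<end : k + rowLength m < firstRow + suc (leftsBelow m)
      k+ℓ<end = subst₂ _<_ (+-comm (rowLength m) k) (sym (rowEnd m<n bm)) (+-monoʳ-< (rowLength m) k<1+m)

    diagonal-size : 1 ≤ n → k ≤ n →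
      diagonalBelow n ≡ length (filter (_<? k) (lefts b n)) ⊓ length (filter (k ≤?_) (n ∷ rights b n))
    diagonal-size 0<n k≤n = begin
      diagonalBelow n
        ≡⟨ diagonalBelow-≥ n k≤n ≤-refl ⟩
      diagonalBelow k
        ≡⟨ diagonalBelow-≤ k≤n k ≤-refl ⟩
      leftsBelow k ∸ (k ∸ firstRow)
        ≡⟨ cong₂ (λ x y → leftsBelow k ∸ (x ∸ y)) (leftsBelow+rightsBelow k) (sym firstRow-split) ⟨
      leftsBelow k ∸ ((leftsBelow k + rightsBelow k) ∸ suc (rightsBelow k + rightsAbove (does ∘ (k ≤?_))))
        ≡⟨ m∸[[m+n]∸[1+n+o]]≡m⊓[1+o] (leftsBelow k) (rightsBelow k) _ ⟩
      leftsBelow k ⊓ suc (rightsAbove (does ∘ (k ≤?_)))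
        ≡⟨ cong₂ _⊓_ #lefts<k (length-filter-rights (k ≤?_) k≤n) ⟨
      length (filter (_<? k) (lefts b n)) ⊓ length (filter (k ≤?_) (n ∷ rights b n)) ∎
      where
      firstRow-split : firstRow ≡ suc (rightsBelow k + rightsAbove (does ∘ (k ≤?_)))
      firstRow-split = trans (firstRow≡ 0<n) (cong suc (countᵇ-upTo-split (not ∘ b) k≤n))
      #lefts<k : length (filter (_<? k) (lefts b n)) ≡ leftsBelow k
      #lefts<k = begin
        length (filter (_<? k) (lefts b n))               ≡⟨ length-filter (_<? k) (lefts b n) ⟩
        countᵇ (does ∘ (_<? k)) (filter (T? ∘ b) (upTo n)) ≡⟨ countᵇ-filter b _ (upTo n) ⟩
        countᵇ (λ x → b x ∧ does (x <? k)) (upTo n)       ≡⟨ countᵇ-upTo-< b k≤n ⟩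
        leftsBelow k                                      ∎

-- Coxeter elements

toℕ-s : ∀ {n} (j : Fin n) x → toℕ (s j x) ≡ swap (toℕ j) (toℕ x)
toℕ-s j x with x Finₚ.≟ inject₁ j
... | yes refl = begin
  toℕ (fsuc j)                      ≡⟨ swap-here (toℕ j) ⟨
  swap (toℕ j) (toℕ j)              ≡⟨ cong (swap (toℕ j)) (Finₚ.toℕ-inject₁ j) ⟨
  swap (toℕ j) (toℕ (inject₁ j))    ∎
... | no x≢j with x Finₚ.≟ fsuc j
...   | yes refl = trans (Finₚ.toℕ-inject₁ j) (sym (swap-next (toℕ j)))
...   | no x≢1+j = sym (swap-other
  (λ x≡j → x≢j (Finₚ.toℕ-injective (trans x≡j (sym (Finₚ.toℕ-inject₁ j)))))
  (x≢1+j ∘ Finₚ.toℕ-injective))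

module _ {n : ℕ} (σ : Permutation′ n) where

  generators : List ℕ
  generators = map toℕ (map (σ ⟨$⟩ʳ_) (allFin n))

  toℕ-coxeter : ∀ x → toℕ (coxeter σ x) ≡ swaps generators (toℕ x)
  toℕ-coxeter = go (map (σ ⟨$⟩ʳ_) (allFin n))
    where
    go : ∀ ws x → toℕ (foldr (λ j f → s j ∘ f) (λ y → y) ws x) ≡ swaps (map toℕ ws) (toℕ x)
    go [] x = refl
    go (w ∷ ws) x =
      trans (toℕ-s w (foldr (λ j f → s j ∘ f) (λ y → y) ws x)) (cong (swap (toℕ w)) (go ws x))

  generators-enumerate : Enumerates n generators
  generators-enumerate =
    Uniqueₚ.map⁺ Finₚ.toℕ-injective (Uniqueₚ.map⁺ σ-injective (Uniqueₚ.allFin⁺ n)) ,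
    (λ x∈ → case ∈-map⁻ toℕ x∈ of λ { (i , _ , refl) → Finₚ.toℕ<n i }) ,
    λ x<n → subst (_∈ generators) (Finₚ.toℕ-fromℕ< x<n) (∈-map⁺ toℕ (σ-hits (fromℕ< x<n)))
    where
    σ-injective : ∀ {i j} → σ ⟨$⟩ʳ i ≡ σ ⟨$⟩ʳ j → i ≡ j
    σ-injective σi≡σj = trans (sym (inverseˡ σ)) (trans (cong (σ ⟨$⟩ˡ_) σi≡σj) (inverseˡ σ))
    σ-hits : ∀ i → i ∈ map (σ ⟨$⟩ʳ_) (allFin n)
    σ-hits i =
      subst (_∈ map (σ ⟨$⟩ʳ_) (allFin n)) (inverseʳ σ) (∈-map⁺ (σ ⟨$⟩ʳ_) (∈-allFin (σ ⟨$⟩ˡ i)))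

module CoxeterCycle {n : ℕ} (σ : Permutation′ n) (0<n : 1 ≤ n) where

  private
    shape = swaps-cycleShape n (generators σ) (generators-enumerate σ)
    c = coxeter σ
    notTop? = λ y → ¬? (y ≟ n)

  b : ℕ → Bool
  b = proj₁ shape

  b0 : b 0 ≡ true
  b0 = proj₁ (proj₂ shape)

  open Counting n b b0

  cycle : List ℕ
  cycle = lefts b n ++ n ∷ rights b n

  toℕ-cycleList : map toℕ (cycleList c) ≡ cycle
  toℕ-cycleList = begin
    map toℕ (map (λ j → iter j c fzero) (upTo (suc n)))
      ≡⟨ cong (map toℕ) (map-iter-upTo c fzero (suc n)) ⟩
    map toℕ (iterate c fzero (suc n))
      ≡⟨ map-iterate toℕ (toℕ-coxeter σ) fzero (suc n) ⟩
    iterate (swaps (generators σ)) 0 (suc n)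
      ≡⟨ cong₂ (iterate _) cycle-head (length-cycle b n) ⟨
    iterate (swaps (generators σ)) (headOr 0 cycle) (length cycle)
      ≡⟨ path-iterate (proj₂ (proj₂ shape)) ⟩
    cycle ∎
    where
    cycle-head : headOr 0 cycle ≡ 0
    cycle-head with lefts-from-0 {b} b0 0<n
    ... | _ , lefts≡ rewrite lefts≡ = refl

  toℕ-notTop : ∀ x → does (¬? (x Finₚ.≟ fromℕ n)) ≡ does (notTop? (toℕ x))
  toℕ-notTop x = cong not (does-⇔ (mk⇔ (λ x≡top → trans (cong toℕ x≡top) (Finₚ.toℕ-fromℕ n))
                                       (λ x≡n → Finₚ.toℕ-injective (trans x≡n (sym (Finₚ.toℕ-fromℕ n)))))
                                  (x Finₚ.≟ fromℕ n) (toℕ x ≟ n))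

  lefts-notTop : All (λ x → ¬ x ≡ n) (lefts b n)
  lefts-notTop = All.map <⇒≢ (lefts-< b n)

  toℕ-leftsWith1 : map toℕ (leftsWith1 c) ≡ lefts b n
  toℕ-leftsWith1 = begin
    map toℕ (leftsWith1 c)                  ≡⟨ map-takeWhile toℕ _ notTop? toℕ-notTop (cycleList c) ⟩
    takeWhile notTop? (map toℕ (cycleList c)) ≡⟨ cong (takeWhile notTop?) toℕ-cycleList ⟩
    takeWhile notTop? cycle                 ≡⟨ takeWhile-++-∷ notTop? lefts-notTop (λ n≢n → n≢n refl) ⟩
    lefts b n                               ∎

  toℕ-rightsWithTop : map toℕ (rightsWithTop c) ≡ n ∷ rights b n
  toℕ-rightsWithTop = begin
    map toℕ (rightsWithTop c)               ≡⟨ map-dropWhile toℕ _ notTop? toℕ-notTop (cycleList c) ⟩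
    dropWhile notTop? (map toℕ (cycleList c)) ≡⟨ cong (dropWhile notTop?) toℕ-cycleList ⟩
    dropWhile notTop? cycle                 ≡⟨ dropWhile-++-∷ notTop? lefts-notTop (λ n≢n → n≢n refl) ⟩
    n ∷ rights b n                          ∎

  toℕ-∈-leftsWith1 : ∀ x → does (MemDec._∈?_ Finₚ._≟_ x (leftsWith1 c)) ≡ does (toℕ x ∈ℕ? lefts b n)
  toℕ-∈-leftsWith1 x = does-⇔ (mk⇔ (λ x∈ → subst (toℕ x ∈_) toℕ-leftsWith1 (∈-map⁺ toℕ x∈)) from)
                               (MemDec._∈?_ Finₚ._≟_ x (leftsWith1 c)) (toℕ x ∈ℕ? lefts b n)
    where
    from : toℕ x ∈ lefts b n → x ∈ leftsWith1 c
    from x∈ with ∈-map⁻ toℕ (subst (toℕ x ∈_) (sym toℕ-leftsWith1) x∈)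
    ... | y , y∈ , x≡y = subst (_∈ leftsWith1 c) (sym (Finₚ.toℕ-injective x≡y)) y∈

  toℕ-sortedLefts : map toℕ (sortedLefts c) ≡ lefts b n
  toℕ-sortedLefts = begin
    map toℕ (sortedLefts c)
      ≡⟨ map-filter toℕ _ (_∈ℕ? lefts b n) toℕ-∈-leftsWith1 (allFin (suc n)) ⟩
    filter (_∈ℕ? lefts b n) (map toℕ (allFin (suc n)))
      ≡⟨ cong (filter (_∈ℕ? lefts b n)) (map-toℕ-allFin (suc n)) ⟩
    filter (_∈ℕ? lefts b n) (upTo (suc n))
      ≡⟨ filter-upTo-suc (_∈ℕ? lefts b n) n ⟩
    filter (_∈ℕ? lefts b n) (upTo n) ++ filter (_∈ℕ? lefts b n) [ n ]
      ≡⟨ cong₂ _++_ (filter-cong-on (_∈ℕ? lefts b n) (T? ∘ b) (All.map ∈lefts⇔ (Allₚ.all-upTo n)))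
                    (filter-reject (_∈ℕ? lefts b n) {n} {[]} (<-irrefl refl ∘ All.lookup (lefts-< b n))) ⟩
    lefts b n ++ []
      ≡⟨ ++-identityʳ (lefts b n) ⟩
    lefts b n ∎
    where
    ∈lefts⇔ : ∀ {x} → x < n → does (x ∈ℕ? lefts b n) ≡ does (T? (b x))
    ∈lefts⇔ {x} x<n =
      does-⇔ (mk⇔ (proj₂ ∘ ∈-filter⁻ (T? ∘ b) {xs = upTo n}) (∈-filter⁺ (T? ∘ b) (∈-upTo⁺ x<n)))
             (x ∈ℕ? lefts b n) (T? (b x))

  partitionOf-coxeter : partitionOf c ≡ map rowLength (lefts b n)
  partitionOf-coxeter = begin
    map (λ a → length (filter (λ r → toℕ a <? toℕ r) (rightsWithTop c))) (sortedLefts c)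
      ≡⟨ map-cong (λ a → length-filter-map-≡ (toℕ a <?_) toℕ-rightsWithTop) (sortedLefts c) ⟩
    map (rowLength ∘ toℕ) (sortedLefts c)   ≡⟨ map-∘ (sortedLefts c) ⟩
    map rowLength (map toℕ (sortedLefts c)) ≡⟨ cong (map rowLength) toℕ-sortedLefts ⟩
    map rowLength (lefts b n)               ∎

lemma3p13 : (n : ℕ) → 1 ≤ n → (σ : Permutation′ n) → (k : ℕ) → 1 ≤ k → k ≤ n →
    length (D k (partitionOf (coxeter σ)))
      ≡ length (filter (λ l → toℕ l <? k) (leftsWith1 (coxeter σ)))
        ⊓ length (filter (λ r → k ≤? toℕ r) (rightsWithTop (coxeter σ)))
lemma3p13 n 0<n σ k _ k≤n = begin
  length (D k (partitionOf (coxeter σ)))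
    ≡⟨ cong (length ∘ D k) partitionOf-coxeter ⟩
  diagonalFrom (head0 (map rowLength (lefts b n))) k 1 (map rowLength (lefts b n))
    ≡⟨ cong (λ h → diagonalFrom h k 1 (map rowLength (lefts b n))) (head0-rows 0<n) ⟩
  diagonalBelow k n
    ≡⟨ diagonal-size k 0<n k≤n ⟩
  length (filter (_<? k) (lefts b n)) ⊓ length (filter (k ≤?_) (n ∷ rights b n))
    ≡⟨ cong₂ _⊓_ (length-filter-map-≡ (_<? k) toℕ-leftsWith1)
                 (length-filter-map-≡ (k ≤?_) toℕ-rightsWithTop) ⟨
  length (filter (λ l → toℕ l <? k) (leftsWith1 (coxeter σ)))
    ⊓ length (filter (λ r → k ≤? toℕ r) (rightsWithTop (coxeter σ))) ∎
  where
  open CoxeterCycle σ 0<n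
  open Counting n b b0
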